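{- Let $n \geq 1$ and let $G$ be the hypertree $HT(n)$. Then the domination number of $G$ is $$\gamma(G) = \begin{cases} \frac{1}{7}(2^{n+2}+3) & \text{if } n\equiv 0 \pmod 3,\\ \frac{1}{7}(2^{n+2}-1) & \text{if } n\equiv 1 \pmod 3,\\ \frac{2}{7}(2^{n+1}-1) & \text{if } n\equiv 2 \pmod 3.\end{cases}$$
   Context: The hypertree $HT(n)$ has vertex set $\{1,2,\dots,2^{n+1}-1\}$. Its edges are the edges of the complete binary tree of height $n$ in which vertex $x$ has children $2x$ and $2x+1$ (the root is $1$, at level $0$; vertex $v$ lies at level $i$ iff $2^i \le v \le 2^{i+1}-1$), together with horizontal edges: for each level $i\ge 1$, two vertices at level $i$ are adjacent if their labels differ by $2^{i-1}$. A set $S\subseteq V(G)$ is dominating if every vertex of $V(G)\setminus S$ is adjacent to some vertex of $S$; $\gamma(G)$ is the minimum cardinality of a dominating set. -}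

module Defs where

open import Data.Nat using (ℕ; zero; suc; _+_; _*_; _∸_; _^_; _≤_; _<_; _%_)
open import Data.Product using (Σ; _×_; ∃-syntax)
open import Data.Sum using (_⊎_)
open import Data.List using (List; length)
open import Data.List.Membership.Propositional using (_∈_)
open import Data.List.Relation.Unary.All using (All)
open import Data.List.Relation.Unary.Any using (Any)
open import Data.List.Relation.Unary.Unique.Propositional using (Unique)
open import Relation.Binary.PropositionalEquality using (_≡_)

IsVertex : ℕ → ℕ → Set
IsVertex n v = 1 ≤ v × v < 2 ^ (suc n)

AtLevel : ℕ → ℕ → Set
AtLevel i v = 2 ^ i ≤ v × v < 2 ^ (suc i)

TreeEdge : ℕ → ℕ → Set
TreeEdge u v = v ≡ 2 * u ⊎ v ≡ 2 * u + 1

-- Horizontal edge at level i ≥ 1 (written i = suc j): labels differ by 2^(i-1) = 2^j.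
HorizEdge : ℕ → ℕ → Set
HorizEdge u v = ∃[ j ] (AtLevel (suc j) u × AtLevel (suc j) v
                        × (v ≡ u + 2 ^ j ⊎ u ≡ v + 2 ^ j))

Adj : ℕ → ℕ → ℕ → Set
Adj n u v = IsVertex n u × IsVertex n v
          × (TreeEdge u v ⊎ TreeEdge v u ⊎ HorizEdge u v)

IsDominating : ℕ → List ℕ → Set
IsDominating n S =
  Unique S × All (IsVertex n) S
  × (∀ v → IsVertex n v → v ∈ S ⊎ Any (λ s → Adj n s v) S)

DominationNumber : ℕ → ℕ → Set
DominationNumber n k =
  (∃[ S ] (IsDominating n S × length S ≡ k))
  × (∀ S → IsDominating n S → k ≤ length S)

-- The paper's closed formula (each numerator is divisible by 7).
open import Data.Nat using (_/_)

formula : ℕ → ℕ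
formula n with n % 3
... | 0 = (2 ^ (n + 2) + 3) / 7
... | 1 = (2 ^ (n + 2) ∸ 1) / 7
... | _ = (2 * (2 ^ (n + 1) ∸ 1)) / 7

-- HT(n) minus its root 1 is a binary tree of horizontal pairs: (2, 3) at
-- level 1, each pair (a, b) having child pairs (2a, 2b) and (2a+1, 2b+1);
-- a vertex of a pair is adjacent only to its partner, parent and children.
-- Lower bound: if a marking dominates a pair tree of height h, it has at
-- least base h + correction marks in that tree, the correction depending on
-- h mod 3 and on whether a, b and their parents are marked.  The induction
-- step and the root step are finite statements about 8 resp. 3 Booleans,
-- verified by evaluation; marks are counted as an indicator sum over
-- 0 … 2^(n+1) − 1, bounded by the length of the set.
-- Upper bound: every third level, from level n − 1 down (ending with the
-- root or level 1), is dominating.  Both bounds are identified with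
-- formula n through the cleared equation 7·X + offsetˡ = 2^(n+2) + offsetʳ.
module Submission where

open import Defs
open import Data.Bool using (Bool; true; false; T; not; _∧_; _∨_)
open import Data.Bool.Properties using (T-∧; T-≡)
open import Data.Bool.ListAction using (or; any)
open import Data.Empty using (⊥-elim)
open import Data.List using (List; []; _∷_; length; applyUpTo; _++_)
open import Data.List.Properties using (length-++; length-applyUpTo)
open import Data.List.Relation.Unary.All using (All; tabulate) renaming (lookup to All-lookup)
open import Data.List.Relation.Unary.Any as Any using (Any; here; there)
open import Data.List.Relation.Unary.Any.Properties using (any⁺)
open import Data.List.Relation.Unary.Unique.Propositional using (Unique)
open import Data.List.Relation.Unary.Unique.Propositional.Properties using (applyUpTo⁺₁; ++⁺)
open import Data.List.Membership.Propositional using (_∈_; find; lose)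
open import Data.List.Membership.Propositional.Properties using (∈-applyUpTo⁺; ∈-applyUpTo⁻; ∈-++⁺ˡ; ∈-++⁺ʳ; ∈-++⁻)
open import Data.Nat
open import Data.Nat.Properties
open import Algebra.Properties.CommutativeSemigroup +-commutativeSemigroup using (x∙yz≈y∙xz; interchange)
open import Data.Nat.DivMod using (m*n/n≡m; [m+n]%n≡m%n)
open import Data.Nat.Tactic.RingSolver using (solve-∀)
open import Data.List.Membership.DecPropositional _≟_ using (_∈?_)
open import Data.Product using (_×_; _,_; proj₁; proj₂; ∃-syntax)
open import Data.Sum using (_⊎_; inj₁; inj₂)
open import Data.Unit using (tt)
open import Function.Bundles using (Equivalence)
open import Relation.Binary.Definitions using (tri<; tri≈; tri>)
open import Relation.Binary.PropositionalEquality
open import Relation.Nullary using (does; yes; no; ¬_)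
open import Relation.Nullary.Decidable using (dec-true; dec-false)

data Phase : Set where
  ph0 ph1 ph2 : Phase

next : Phase → Phase
next ph0 = ph1
next ph1 = ph2
next ph2 = ph0

phase : ℕ → Phase
phase zero = ph0
phase (suc h) = next (phase h)

residue : Phase → ℕ
residue ph0 = 0
residue ph1 = 1
residue ph2 = 2

phase-periodic : ∀ n → phase (3 + n) ≡ phase n
phase-periodic n with phase n
... | ph0 = refl
... | ph1 = refl
... | ph2 = refl

phase-residue : ∀ n → n % 3 ≡ residue (phase n)
phase-residue zero = refl
phase-residue (suc zero) = refl
phase-residue (suc (suc zero)) = refl
phase-residue (suc (suc (suc n))) = begin
  (3 + n) % 3            ≡⟨ cong (_% 3) (+-comm 3 n) ⟩
  (n + 3) % 3            ≡⟨ [m+n]%n≡m%n n 3 ⟩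
  n % 3                  ≡⟨ phase-residue n ⟩
  residue (phase n)      ≡⟨ cong residue (sym (phase-periodic n)) ⟩
  residue (phase (3 + n)) ∎
  where open ≡-Reasoning

-- The formula of the theorem, cleared of its division by 7:
-- 7·X + offsetˡ = 2^(n+2) + offsetʳ, with offsets depending on n mod 3.
offsetˡ : Phase → ℕ
offsetˡ ph0 = 0
offsetˡ ph1 = 1
offsetˡ ph2 = 2

offsetʳ : Phase → ℕ
offsetʳ ph0 = 3
offsetʳ _ = 0

ClosedForm : ℕ → ℕ → Set
ClosedForm n X = 7 * X + offsetˡ (phase n) ≡ 2 ^ (2 + n) + offsetʳ (phase n)

closedForm⇒formula : ∀ n X → ClosedForm n X → formula n ≡ X
closedForm⇒formula n X eq with phase n | phase-residue n
... | ph0 | r rewrite r | +-comm n 2 | sym eq =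
  trans (cong (_/ 7) (trans (+-identityʳ (7 * X)) (*-comm 7 X))) (m*n/n≡m X 7)
... | ph1 | r rewrite r | +-comm n 2 | +-identityʳ (2 ^ (2 + n)) | sym eq =
  trans (cong (_/ 7) (trans (m+n∸n≡m (7 * X) 1) (*-comm 7 X))) (m*n/n≡m X 7)
... | ph2 | r rewrite r | +-comm n 1 = trans (cong (_/ 7) numerator) (m*n/n≡m X 7)
  where
  open ≡-Reasoning
  numerator : 2 * (2 ^ suc n ∸ 1) ≡ X * 7
  numerator = begin
    2 * (2 ^ suc n ∸ 1)   ≡⟨ *-distribˡ-∸ 2 (2 ^ suc n) 1 ⟩
    2 ^ (2 + n) ∸ 2       ≡⟨ cong (_∸ 2) (trans (sym (+-identityʳ _)) (sym eq)) ⟩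
    7 * X + 2 ∸ 2         ≡⟨ m+n∸n≡m (7 * X) 2 ⟩
    7 * X                 ≡⟨ *-comm 7 X ⟩
    X * 7                 ∎

-- Lower bound for a pair tree of height h, before boundary correction:
-- the two child trees, plus 2 when passing from phase 1 to phase 2.
growth : Phase → ℕ
growth ph1 = 2
growth _ = 0

base : ℕ → ℕ
base zero = 0
base (suc h) = 2 * base h + growth (phase h)

-- Extra vertex forced by the root of HT(n).
rootBonus : Phase → ℕ
rootBonus ph2 = 0
rootBonus _ = 1

base-closedForm : ∀ n → ClosedForm n (base n + rootBonus (phase n))
base-closedForm zero = refl
base-closedForm (suc n) with phase n | base-closedForm n
... | ph0 | ih = +-cancelʳ-≡ 6 _ _ (trans (lhs (base n)) (trans (cong (2 *_) ih) (rhs (2 ^ (2 + n)))))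
  where
  lhs : ∀ B → 7 * (2 * B + 0 + 1) + 1 + 6 ≡ 2 * (7 * (B + 1) + 0)
  lhs = solve-∀
  rhs : ∀ X → 2 * (X + 3) ≡ 2 * X + 0 + 6
  rhs = solve-∀
... | ph1 | ih = trans (lhs (base n)) (trans (cong (2 *_) ih) (rhs (2 ^ (2 + n))))
  where
  lhs : ∀ B → 7 * (2 * B + 2 + 0) + 2 ≡ 2 * (7 * (B + 1) + 1)
  lhs = solve-∀
  rhs : ∀ X → 2 * (X + 0) ≡ 2 * X + 0
  rhs = solve-∀
... | ph2 | ih = trans (lhs (base n)) (trans (cong (λ z → 2 * z + 3) ih) (rhs (2 ^ (2 + n))))
  where
  lhs : ∀ B → 7 * (2 * B + 0 + 1) + 0 ≡ 2 * (7 * (B + 0) + 2) + 3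
  lhs = solve-∀
  rhs : ∀ X → 2 * (X + 0) + 3 ≡ 2 * X + 3
  rhs = solve-∀

bit : Bool → ℕ
bit true = 1
bit false = 0

Pred : ℕ → Set
Pred zero = Bool
Pred (suc k) = Bool → Pred k

Valid : (k : ℕ) → Pred k → Set
Valid zero b = T b
Valid (suc k) f = ∀ x → Valid k (f x)

check : (k : ℕ) → Pred k → Bool
check zero b = b
check (suc k) f = check k (f true) ∧ check k (f false)

check-sound : ∀ k f → T (check k f) → Valid k f
check-sound zero b t = t
check-sound (suc k) f t true = check-sound k (f true) (proj₁ (Equivalence.to T-∧ t))
check-sound (suc k) f t false = check-sound k (f false) (proj₂ (Equivalence.to T-∧ t))

-- Boundary correction for a pair (a, b) of height h in phase p: extra
-- vertices forced in its pair tree, given whether a, b are chosen (xa, xb)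
-- and whether their parents are chosen (ea, eb).
correction : Phase → Bool → Bool → Bool → Bool → ℕ
correction ph1 false false ea eb = 2 ∸ (bit ea + bit eb)
correction ph2 true true _ _ = 0
correction _ xa xb _ _ = bit xa + bit xb

implication : ∀ {x y} → T (not x ∨ y) → T x → T y
implication {true} t _ = t

-- One level of the pair-tree recursion: if both a and b are dominated
-- (a by one of a, b, its parent, its children), the bound for height
-- h + 1 follows from the bounds of the two child pairs at height h.
stepCheck : Phase → Pred 8
stepCheck p xa xb ea eb c1a c1b c2a c2b =
  not (or (xa ∷ xb ∷ ea ∷ c1a ∷ c2a ∷ []) ∧ or (xb ∷ xa ∷ eb ∷ c1b ∷ c2b ∷ []))
  ∨ (growth p + correction (next p) xa xb ea eb
       ≤ᵇ bit xa + bit xb + correction p c1a c1b xa xb + correction p c2a c2b xa xb)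

stepCheck-valid : ∀ p → Valid 8 (stepCheck p)
stepCheck-valid ph0 = check-sound 8 (stepCheck ph0) tt
stepCheck-valid ph1 = check-sound 8 (stepCheck ph1) tt
stepCheck-valid ph2 = check-sound 8 (stepCheck ph2) tt

step-bound : ∀ p xa xb ea eb c1a c1b c2a c2b →
  T (or (xa ∷ xb ∷ ea ∷ c1a ∷ c2a ∷ [])) → T (or (xb ∷ xa ∷ eb ∷ c1b ∷ c2b ∷ [])) →
  growth p + correction (next p) xa xb ea eb
    ≤ bit xa + bit xb + correction p c1a c1b xa xb + correction p c2a c2b xa xb
step-bound p xa xb ea eb c1a c1b c2a c2b domA domB =
  ≤ᵇ⇒≤ _ _ (implication (stepCheck-valid p xa xb ea eb c1a c1b c2a c2b)
                         (Equivalence.from T-∧ (domA , domB)))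

-- The root 1 of HT(n), adjacent to the top pair (2, 3) of height n.
rootCheck : Phase → Pred 3
rootCheck p x1 c2 c3 =
  not (or (x1 ∷ c2 ∷ c3 ∷ [])) ∨ (rootBonus p ≤ᵇ bit x1 + correction p c2 c3 x1 x1)

root-bound : ∀ p x1 c2 c3 → T (or (x1 ∷ c2 ∷ c3 ∷ [])) →
  rootBonus p ≤ bit x1 + correction p c2 c3 x1 x1
root-bound p x1 c2 c3 dom1 = ≤ᵇ⇒≤ _ _ (implication (valid p x1 c2 c3) dom1)
  where
  valid : ∀ p → Valid 3 (rootCheck p)
  valid ph0 = check-sound 3 (rootCheck ph0) tt
  valid ph1 = check-sound 3 (rootCheck ph1) tt
  valid ph2 = check-sound 3 (rootCheck ph2) tt

sumBelow : ℕ → (ℕ → ℕ) → ℕ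
sumBelow zero f = 0
sumBelow (suc k) f = f 0 + sumBelow k (λ t → f (suc t))

sumBelow-cong : ∀ k {f g : ℕ → ℕ} → (∀ t → f t ≡ g t) → sumBelow k f ≡ sumBelow k g
sumBelow-cong zero e = refl
sumBelow-cong (suc k) e = cong₂ _+_ (e 0) (sumBelow-cong k (λ t → e (suc t)))

sumBelow-+ : ∀ k l (f : ℕ → ℕ) → sumBelow (k + l) f ≡ sumBelow k f + sumBelow l (λ t → f (k + t))
sumBelow-+ zero l f = refl
sumBelow-+ (suc k) l f =
  trans (cong (f 0 +_) (sumBelow-+ k l (λ t → f (suc t)))) (sym (+-assoc (f 0) _ _))

sumBelow-zero : ∀ k → sumBelow k (λ _ → 0) ≡ 0
sumBelow-zero zero = refl
sumBelow-zero (suc k) = sumBelow-zero k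

sumBelow-mono : ∀ k {f g : ℕ → ℕ} → (∀ t → f t ≤ g t) → sumBelow k f ≤ sumBelow k g
sumBelow-mono zero le = z≤n
sumBelow-mono (suc k) le = +-mono-≤ (le 0) (sumBelow-mono k (λ t → le (suc t)))

sumBelow-pointwise-+ : ∀ k (f g : ℕ → ℕ) →
  sumBelow k (λ t → f t + g t) ≡ sumBelow k f + sumBelow k g
sumBelow-pointwise-+ zero f g = refl
sumBelow-pointwise-+ (suc k) f g =
  trans (cong (f 0 + g 0 +_) (sumBelow-pointwise-+ k (λ t → f (suc t)) (λ t → g (suc t))))
        (interchange (f 0) (g 0) _ _)

occurs-once : ∀ N x → sumBelow N (λ v → bit (v ≡ᵇ x)) ≤ 1
occurs-once zero x = z≤n
occurs-once (suc N) zero = ≤-reflexive (cong suc (sumBelow-zero N))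
occurs-once (suc N) (suc x) = occurs-once N x

bit-∨ : ∀ x y → bit (x ∨ y) ≤ bit x + bit y
bit-∨ true y = s≤s z≤n
bit-∨ false y = ≤-refl

members-below : ∀ N S → sumBelow N (λ v → bit (does (v ∈? S))) ≤ length S
members-below N [] = ≤-reflexive (sumBelow-zero N)
members-below N (x ∷ S) = begin
  sumBelow N (λ v → bit (does (v ∈? (x ∷ S))))
    ≤⟨ sumBelow-mono N (λ v → bit-∨ (v ≡ᵇ x) (does (v ∈? S))) ⟩
  sumBelow N (λ v → bit (v ≡ᵇ x) + bit (does (v ∈? S)))
    ≡⟨ sumBelow-pointwise-+ N _ _ ⟩
  sumBelow N (λ v → bit (v ≡ᵇ x)) + sumBelow N (λ v → bit (does (v ∈? S)))
    ≤⟨ +-mono-≤ (occurs-once N x) (members-below N S) ⟩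
  suc (length S) ∎
  where open ≤-Reasoning

module Marked (χ : ℕ → Bool) where

  marked : ℕ → ℕ
  marked v = bit (χ v)

  subtree : ℕ → ℕ → ℕ
  subtree zero a = 0
  subtree (suc h) a = marked a + subtree h (2 * a) + subtree h (suc (2 * a))

  layer : ℕ → ℕ → ℕ
  layer d a = sumBelow (2 ^ d) (λ t → marked (2 ^ d * a + t))

  layer-split : ∀ d a → layer (suc d) a ≡ layer d (2 * a) + layer d (suc (2 * a))
  layer-split d a =
    trans (cong (λ k → sumBelow (2 ^ d + k) lower) (+-identityʳ (2 ^ d)))
      (trans (sumBelow-+ (2 ^ d) (2 ^ d) lower)
        (cong₂ _+_ (sumBelow-cong (2 ^ d) (λ t → cong (λ v → marked (v + t)) (left (2 ^ d) a)))
                   (sumBelow-cong (2 ^ d) (λ t → cong marked (right (2 ^ d) a t)))))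
    where
    lower : ℕ → ℕ
    lower t = marked (2 ^ suc d * a + t)
    left : ∀ X a → 2 * X * a ≡ X * (2 * a)
    left = solve-∀
    right : ∀ X a t → 2 * X * a + (X + t) ≡ X * (1 + 2 * a) + t
    right = solve-∀

  subtree-peel : ∀ h a → subtree (suc h) a ≡ subtree h a + layer h a
  subtree-peel zero a =
    trans (+-identityʳ (marked a + 0)) (cong (λ v → marked v + 0)
      (sym (trans (+-identityʳ (1 * a)) (*-identityˡ a))))
  subtree-peel (suc h) a = begin
    marked a + subtree (suc h) (2 * a) + subtree (suc h) (suc (2 * a))
      ≡⟨ cong₂ (λ l r → marked a + l + r) (subtree-peel h (2 * a)) (subtree-peel h (suc (2 * a))) ⟩
    marked a + (subtree h (2 * a) + layer h (2 * a)) + (subtree h (suc (2 * a)) + layer h (suc (2 * a)))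
      ≡⟨ regroup (marked a) (subtree h (2 * a)) (layer h (2 * a)) _ _ ⟩
    subtree (suc h) a + (layer h (2 * a) + layer h (suc (2 * a)))
      ≡⟨ cong (subtree (suc h) a +_) (sym (layer-split h a)) ⟩
    subtree (suc h) a + layer (suc h) a ∎
    where
    open ≡-Reasoning
    regroup : ∀ m s l s' l' → m + (s + l) + (s' + l') ≡ m + s + s' + (l + l')
    regroup = solve-∀

  prefix-count : ∀ k → sumBelow (2 ^ k) marked ≡ marked 0 + subtree k 1
  prefix-count zero = refl
  prefix-count (suc k) = begin
    sumBelow (2 ^ k + (2 ^ k + 0)) marked
      ≡⟨ cong (λ l → sumBelow (2 ^ k + l) marked) (+-identityʳ (2 ^ k)) ⟩
    sumBelow (2 ^ k + 2 ^ k) marked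
      ≡⟨ sumBelow-+ (2 ^ k) (2 ^ k) marked ⟩
    sumBelow (2 ^ k) marked + sumBelow (2 ^ k) (λ t → marked (2 ^ k + t))
      ≡⟨ cong₂ _+_ (prefix-count k)
           (sumBelow-cong (2 ^ k) (λ t → cong (λ v → marked (v + t)) (sym (*-identityʳ (2 ^ k))))) ⟩
    marked 0 + subtree k 1 + layer k 1
      ≡⟨ +-assoc (marked 0) _ _ ⟩
    marked 0 + (subtree k 1 + layer k 1)
      ≡⟨ cong (marked 0 +_) (sym (subtree-peel k 1)) ⟩
    marked 0 + subtree (suc k) 1 ∎
    where open ≡-Reasoning

module PairBound (χ : ℕ → Bool) where
  open Marked χ

  -- Every vertex of the pair tree of height h at (a, b) is dominated by χ,
  -- the parents of a and b having marks ea and eb; below the tree (height 0)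
  -- nothing is marked.
  Dominated : ℕ → ℕ → ℕ → Bool → Bool → Set
  Dominated zero a b ea eb = χ a ≡ false × χ b ≡ false
  Dominated (suc h) a b ea eb =
    T (or (χ a ∷ χ b ∷ ea ∷ χ (2 * a) ∷ χ (suc (2 * a)) ∷ []))
    × T (or (χ b ∷ χ a ∷ eb ∷ χ (2 * b) ∷ χ (suc (2 * b)) ∷ []))
    × Dominated h (2 * a) (2 * b) (χ a) (χ b)
    × Dominated h (suc (2 * a)) (suc (2 * b)) (χ a) (χ b)

  pair-bound : ∀ h a b ea eb → Dominated h a b ea eb →
    base h + correction (phase h) (χ a) (χ b) ea eb ≤ subtree h a + subtree h b
  pair-bound zero a b ea eb (unmarkedA , unmarkedB) rewrite unmarkedA | unmarkedB = z≤n
  pair-bound (suc h) a b ea eb (domA , domB , dom₁ , dom₂) = begin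
    base (suc h) + correction (next p) xa xb ea eb
      ≡⟨ split (base h) (growth p) _ ⟩
    base h + base h + (growth p + correction (next p) xa xb ea eb)
      ≤⟨ +-monoʳ-≤ (base h + base h)
           (step-bound p xa xb ea eb (χ (2 * a)) (χ (2 * b)) (χ (suc (2 * a))) (χ (suc (2 * b))) domA domB) ⟩
    base h + base h + (bit xa + bit xb + correction p (χ (2 * a)) (χ (2 * b)) xa xb
                                       + correction p (χ (suc (2 * a))) (χ (suc (2 * b))) xa xb)
      ≡⟨ distribute (base h) (bit xa) (bit xb) _ _ ⟩
    bit xa + bit xb + (base h + correction p (χ (2 * a)) (χ (2 * b)) xa xb)
                    + (base h + correction p (χ (suc (2 * a))) (χ (suc (2 * b))) xa xb)
      ≤⟨ +-mono-≤ (+-monoʳ-≤ (bit xa + bit xb) (pair-bound h (2 * a) (2 * b) xa xb dom₁))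
                  (pair-bound h (suc (2 * a)) (suc (2 * b)) xa xb dom₂) ⟩
    bit xa + bit xb + (subtree h (2 * a) + subtree h (2 * b))
                    + (subtree h (suc (2 * a)) + subtree h (suc (2 * b)))
      ≡⟨ regroup (bit xa) (bit xb) _ _ _ _ ⟩
    subtree (suc h) a + subtree (suc h) b ∎
    where
    open ≤-Reasoning
    p : Phase
    p = phase h
    xa xb : Bool
    xa = χ a
    xb = χ b
    split : ∀ B g d → 2 * B + g + d ≡ B + B + (g + d)
    split = solve-∀
    distribute : ∀ B x y d₁ d₂ → B + B + (x + y + d₁ + d₂) ≡ x + y + (B + d₁) + (B + d₂)
    distribute = solve-∀
    regroup : ∀ x y s₁ t₁ s₂ t₂ → x + y + (s₁ + t₁) + (s₂ + t₂) ≡ x + s₁ + s₂ + (y + t₁ + t₂)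
    regroup = solve-∀

level-unique : ∀ {i j v} → AtLevel i v → AtLevel j v → i ≡ j
level-unique {i} {j} (lowerᵢ , upperᵢ) (lowerⱼ , upperⱼ) with <-cmp i j
... | tri≈ _ i≡j _ = i≡j
... | tri< i<j _ _ = ⊥-elim (<⇒≱ upperᵢ (≤-trans (^-monoʳ-≤ 2 i<j) lowerⱼ))
... | tri> _ _ j<i = ⊥-elim (<⇒≱ upperⱼ (≤-trans (^-monoʳ-≤ 2 j<i) lowerᵢ))

parent-unique : ∀ {s p a} → TreeEdge s a → TreeEdge p a → s ≡ p
parent-unique {s} {p} (inj₁ e₁) (inj₁ e₂) = *-cancelˡ-≡ s p 2 (trans (sym e₁) e₂)
parent-unique {s} {p} (inj₁ e₁) (inj₂ e₂) =
  ⊥-elim (even≢odd s p (trans (sym e₁) (trans e₂ (+-comm _ 1))))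
parent-unique {s} {p} (inj₂ e₁) (inj₁ e₂) =
  ⊥-elim (even≢odd p s (trans (sym e₂) (trans e₁ (+-comm _ 1))))
parent-unique {s} {p} (inj₂ e₁) (inj₂ e₂) =
  *-cancelˡ-≡ s p 2 (+-cancelʳ-≡ 1 _ _ (trans (sym e₁) e₂))

level-vertex : ∀ {n l v} → AtLevel l v → l ≤ n → IsVertex n v
level-vertex {l = l} (lower , upper) l≤n =
  ≤-trans (m^n>0 2 l) lower , ≤-trans upper (^-monoʳ-≤ 2 (s≤s l≤n))

-- a lies in the left half of level j + 1; its horizontal partner is a + 2^j.
LeftHalf : ℕ → ℕ → Set
LeftHalf j a = 2 * 2 ^ j ≤ a × a < 2 * 2 ^ j + 2 ^ j

module Pair {j a b : ℕ} (left : LeftHalf j a) (partner : b ≡ a + 2 ^ j) where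

  private
    four : ∀ X → 2 * X + X + X ≡ 2 * (2 * X)
    four = solve-∀

    three≤four : ∀ X → 2 * X + X ≤ 2 * (2 * X)
    three≤four X = ≤-trans (m≤m+n (2 * X + X) X) (≤-reflexive (four X))

    b≥a+ : a + 2 ^ j ≤ b
    b≥a+ = ≤-reflexive (sym partner)

  a-level : AtLevel (suc j) a
  a-level = proj₁ left , ≤-trans (proj₂ left) (three≤four (2 ^ j))

  b-level : AtLevel (suc j) b
  b-level = ≤-trans (proj₁ left) (≤-trans (m≤m+n a (2 ^ j)) b≥a+)
          , (begin-strict
              b                       ≡⟨ partner ⟩
              a + 2 ^ j               <⟨ +-monoˡ-< (2 ^ j) (proj₂ left) ⟩
              2 * 2 ^ j + 2 ^ j + 2 ^ j ≡⟨ four (2 ^ j) ⟩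
              2 * (2 * 2 ^ j)         ∎)
    where open ≤-Reasoning

  children-left : LeftHalf (suc j) (2 * a) × LeftHalf (suc j) (suc (2 * a))
  children-left = (lower , ≤-trans (n≤1+n _) upper) , (≤-trans lower (n≤1+n _) , upper)
    where
    lower : 2 * 2 ^ suc j ≤ 2 * a
    lower = *-monoʳ-≤ 2 (proj₁ left)
    upper : suc (suc (2 * a)) ≤ 2 * 2 ^ suc j + 2 ^ suc j
    upper = begin
      suc (suc (2 * a))           ≡⟨ double-suc a ⟩
      2 * suc a                   ≤⟨ *-monoʳ-≤ 2 (proj₂ left) ⟩
      2 * (2 * 2 ^ j + 2 ^ j)     ≡⟨ distrib (2 ^ j) ⟩
      2 * 2 ^ suc j + 2 ^ suc j   ∎
      where
      open ≤-Reasoning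
      double-suc : ∀ a → suc (suc (2 * a)) ≡ 2 * suc a
      double-suc = solve-∀
      distrib : ∀ X → 2 * (2 * X + X) ≡ 2 * (2 * X) + 2 * X
      distrib = solve-∀

  children-partner : 2 * b ≡ 2 * a + 2 ^ suc j
  children-partner = trans (cong (2 *_) partner) (*-distribˡ-+ 2 a (2 ^ j))

  nbhd-a : ∀ {n s pa} → TreeEdge pa a → Adj n s a → s ∈ b ∷ pa ∷ 2 * a ∷ suc (2 * a) ∷ []
  nbhd-a parent (_ , _ , inj₁ up) = there (here (parent-unique up parent))
  nbhd-a parent (_ , _ , inj₂ (inj₁ (inj₁ e))) = there (there (here e))
  nbhd-a parent (_ , _ , inj₂ (inj₁ (inj₂ e))) = there (there (there (here (trans e (+-comm _ 1)))))
  nbhd-a parent (_ , _ , inj₂ (inj₂ (j′ , s-level , a-level′ , across)))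
    with level-unique {suc j′} {suc j} {a} a-level′ a-level
  ... | refl with across
  ...   | inj₂ e = here (trans e (sym partner))
  ...   | inj₁ e = ⊥-elim (<⇒≱ (proj₂ left)
                     (≤-trans (+-monoˡ-≤ (2 ^ j) (proj₁ s-level)) (≤-reflexive (sym e))))

  nbhd-b : ∀ {n s pb} → TreeEdge pb b → Adj n s b → s ∈ a ∷ pb ∷ 2 * b ∷ suc (2 * b) ∷ []
  nbhd-b parent (_ , _ , inj₁ up) = there (here (parent-unique up parent))
  nbhd-b parent (_ , _ , inj₂ (inj₁ (inj₁ e))) = there (there (here e))
  nbhd-b parent (_ , _ , inj₂ (inj₁ (inj₂ e))) = there (there (there (here (trans e (+-comm _ 1)))))
  nbhd-b {s = s} parent (_ , _ , inj₂ (inj₂ (j′ , s-level , b-level′ , across)))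
    with level-unique {suc j′} {suc j} {b} b-level′ b-level
  ... | refl with across
  ...   | inj₁ e = here (+-cancelʳ-≡ (2 ^ j) s a (trans (sym e) partner))
  ...   | inj₂ e = ⊥-elim (<⇒≱ (proj₂ s-level) (begin
      2 * (2 * 2 ^ j)            ≡⟨ sym (four (2 ^ j)) ⟩
      2 * 2 ^ j + 2 ^ j + 2 ^ j  ≤⟨ +-monoˡ-≤ (2 ^ j) (+-monoˡ-≤ (2 ^ j) (proj₁ left)) ⟩
      a + 2 ^ j + 2 ^ j          ≡⟨ cong (_+ 2 ^ j) (sym partner) ⟩
      b + 2 ^ j                  ≡⟨ sym e ⟩
      s                          ∎))
    where open ≤-Reasoning

nbhd-root : ∀ {n s} → Adj n s 1 → s ∈ 2 ∷ 3 ∷ []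
nbhd-root {s = s} ((positive , _) , _ , inj₁ (inj₁ e)) = ⊥-elim (even≢odd s 0 (sym e))
nbhd-root ((positive , _) , _ , inj₁ (inj₂ e)) =
  ⊥-elim (<⇒≱ (s≤s (s≤s z≤n)) (≤-trans (+-monoˡ-≤ 1 (*-monoʳ-≤ 2 positive)) (≤-reflexive (sym e))))
nbhd-root (_ , _ , inj₂ (inj₁ (inj₁ e))) = here e
nbhd-root (_ , _ , inj₂ (inj₁ (inj₂ e))) = there (here e)
nbhd-root (_ , _ , inj₂ (inj₂ (j , _ , (lower , _) , _))) =
  ⊥-elim (<⇒≱ (s≤s (s≤s z≤n)) (≤-trans (*-monoʳ-≤ 2 (m^n>0 2 j)) lower))

module Dominating {n : ℕ} {S : List ℕ} (dom : IsDominating n S) where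

  χ : ℕ → Bool
  χ v = does (v ∈? S)

  open PairBound χ

  member-marked : ∀ {v} → v ∈ S → T (χ v)
  member-marked {v} v∈S = Equivalence.from T-≡ (dec-true (v ∈? S) v∈S)

  outside-unmarked : ∀ {v} → ¬ IsVertex n v → χ v ≡ false
  outside-unmarked {v} v∉HT = dec-false (v ∈? S) (λ v∈S → v∉HT (All-lookup (proj₁ (proj₂ dom)) v∈S))

  closed-nbhd-marked : ∀ {v} N → IsVertex n v → (∀ {s} → Adj n s v → s ∈ N) → T (any χ (v ∷ N))
  closed-nbhd-marked {v} N v-vertex nbhd with proj₂ (proj₂ dom) v v-vertex
  ... | inj₁ v∈S = any⁺ {xs = v ∷ N} χ (here (member-marked v∈S))
  ... | inj₂ adjacent with find adjacent
  ...   | s , s∈S , s~v = any⁺ {xs = v ∷ N} χ (there (Any.map (λ { refl → member-marked s∈S }) (nbhd s~v)))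

  pairs-dominated : ∀ h {j a b pa pb} → suc j + h ≡ suc n → LeftHalf j a → b ≡ a + 2 ^ j →
    TreeEdge pa a → TreeEdge pb b → Dominated h a b (χ pa) (χ pb)
  pairs-dominated zero {j} {a} {b} depth left partner _ _ =
    outside-unmarked (beyond a-level) , outside-unmarked (beyond b-level)
    where
    open Pair {j} {a} {b} left partner
    j≡n : j ≡ n
    j≡n = suc-injective (trans (sym (+-identityʳ (suc j))) depth)
    beyond : ∀ {v} → AtLevel (suc j) v → ¬ IsVertex n v
    beyond (lower , _) (_ , upper) = <⇒≱ upper (subst (λ k → 2 ^ suc k ≤ _) j≡n lower)
  pairs-dominated (suc h) {j} {a} {b} {pa} {pb} depth left partner a-parent b-parent =
    closed-nbhd-marked (b ∷ pa ∷ 2 * a ∷ suc (2 * a) ∷ []) (level-vertex a-level j+1≤n) (nbhd-a {n} a-parent) ,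
    closed-nbhd-marked (a ∷ pb ∷ 2 * b ∷ suc (2 * b) ∷ []) (level-vertex b-level j+1≤n) (nbhd-b {n} b-parent) ,
    pairs-dominated h depth′ (proj₁ children-left) children-partner (inj₁ refl) (inj₁ refl) ,
    pairs-dominated h depth′ (proj₂ children-left) (cong suc children-partner)
                    (inj₂ (+-comm 1 _)) (inj₂ (+-comm 1 _))
    where
    open Pair {j} {a} {b} left partner
    depth′ : suc (suc j) + h ≡ suc n
    depth′ = trans (sym (+-suc (suc j) h)) depth
    j+1≤n : suc j ≤ n
    j+1≤n = s≤s⁻¹ (≤-trans (s≤s (m≤m+n (suc j) h)) (≤-reflexive depth′))

  root-dominated : T (any χ (1 ∷ 2 ∷ 3 ∷ []))
  root-dominated = closed-nbhd-marked (2 ∷ 3 ∷ []) (≤-refl , *-monoʳ-≤ 2 (m^n>0 2 n)) (nbhd-root {n})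

  top-pair-dominated : Dominated n 2 3 (χ 1) (χ 1)
  top-pair-dominated = pairs-dominated n refl (≤-refl , ≤-refl) refl (inj₁ refl) (inj₂ refl)

lower-bound : ∀ n S → IsDominating n S → formula n ≤ length S
lower-bound n S dom = begin
  formula n
    ≡⟨ closedForm⇒formula n _ (base-closedForm n) ⟩
  base n + rootBonus (phase n)
    ≤⟨ +-monoʳ-≤ (base n) (root-bound (phase n) (χ 1) (χ 2) (χ 3) root-dominated) ⟩
  base n + (marked 1 + correction (phase n) (χ 2) (χ 3) (χ 1) (χ 1))
    ≡⟨ x∙yz≈y∙xz (base n) (marked 1) _ ⟩
  marked 1 + (base n + correction (phase n) (χ 2) (χ 3) (χ 1) (χ 1))
    ≤⟨ +-monoʳ-≤ (marked 1) (pair-bound n 2 3 (χ 1) (χ 1) top-pair-dominated) ⟩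
  marked 1 + (subtree n 2 + subtree n 3)
    ≡⟨ sym (+-assoc (marked 1) _ _) ⟩
  subtree (suc n) 1
    ≤⟨ m≤n+m _ (marked 0) ⟩
  marked 0 + subtree (suc n) 1
    ≡⟨ sym (prefix-count (suc n)) ⟩
  sumBelow (2 ^ suc n) marked
    ≤⟨ members-below (2 ^ suc n) S ⟩
  length S ∎
  where
  open Dominating {n} {S} dom
  open Marked χ
  open PairBound χ
  open ≤-Reasoning

level : ℕ → List ℕ
level l = applyUpTo (2 ^ l +_) (2 ^ l)

level⁻ : ∀ l {v} → v ∈ level l → AtLevel l v
level⁻ l v∈ with ∈-applyUpTo⁻ (2 ^ l +_) v∈
... | t , t< , refl =
  m≤m+n (2 ^ l) t , ≤-trans (+-monoʳ-< (2 ^ l) t<) (≤-reflexive (cong (2 ^ l +_) (sym (+-identityʳ _))))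

level⁺ : ∀ l {v} → AtLevel l v → v ∈ level l
level⁺ l {v} (lower , upper) = subst (_∈ level l) (m+[n∸m]≡n lower) (∈-applyUpTo⁺ (2 ^ l +_) offset<)
  where
  offset< : v ∸ 2 ^ l < 2 ^ l
  offset< = +-cancelˡ-< (2 ^ l) _ _
    (≤-trans (≤-reflexive (cong suc (m+[n∸m]≡n lower)))
             (≤-trans upper (≤-reflexive (cong (2 ^ l +_) (+-identityʳ _)))))

level-unique-elements : ∀ l → Unique (level l)
level-unique-elements l = applyUpTo⁺₁ _ (2 ^ l) (λ i<j _ eq → <⇒≢ i<j (+-cancelˡ-≡ (2 ^ l) _ _ eq))

chosen : ℕ → List ℕ
chosen zero = level 0
chosen (suc zero) = level 0
chosen (suc (suc zero)) = level 1
chosen (suc (suc (suc n))) = level (suc (suc n)) ++ chosen n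

-- Its size is formula n: levels n − 1, n − 4, … contribute 2^(n−1) + 2^(n−4) + ….
chosen-closedForm : ∀ n → ClosedForm n (length (chosen n))
chosen-closedForm zero = refl
chosen-closedForm (suc zero) = refl
chosen-closedForm (suc (suc zero)) = refl
chosen-closedForm (suc (suc (suc n)))
  rewrite phase-periodic n | length-++ (level (suc (suc n))) {chosen n}
        | length-applyUpTo (2 ^ suc (suc n) +_) (2 ^ suc (suc n)) =
  trans (split (2 ^ suc (suc n)) (length (chosen n)) (offsetˡ (phase n)))
    (trans (cong (7 * 2 ^ suc (suc n) +_) (chosen-closedForm n))
           (merge (2 ^ suc (suc n)) (offsetʳ (phase n))))
  where
  split : ∀ Y L a → 7 * (Y + L) + a ≡ 7 * Y + (7 * L + a)
  split = solve-∀
  merge : ∀ Y b → 7 * Y + (Y + b) ≡ 2 * (2 * (2 * Y)) + b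
  merge = solve-∀

chosen-levels : ∀ n {v} → v ∈ chosen n → ∃[ l ] (l ≤ n × AtLevel l v)
chosen-levels zero v∈ = 0 , z≤n , level⁻ 0 v∈
chosen-levels (suc zero) v∈ = 0 , z≤n , level⁻ 0 v∈
chosen-levels (suc (suc zero)) v∈ = 1 , s≤s z≤n , level⁻ 1 v∈
chosen-levels (suc (suc (suc n))) v∈ with ∈-++⁻ (level (suc (suc n))) v∈
... | inj₁ v∈top = suc (suc n) , n≤1+n _ , level⁻ (suc (suc n)) v∈top
... | inj₂ v∈rest with chosen-levels n v∈rest
...   | l , l≤n , at = l , m≤n⇒m≤o+n 3 l≤n , at

chosen-vertices : ∀ n → All (IsVertex n) (chosen n)
chosen-vertices n = tabulate λ v∈ → let (l , l≤n , at) = chosen-levels n v∈ in level-vertex at l≤n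

chosen-unique : ∀ n → Unique (chosen n)
chosen-unique zero = level-unique-elements 0
chosen-unique (suc zero) = level-unique-elements 0
chosen-unique (suc (suc zero)) = level-unique-elements 1
chosen-unique (suc (suc (suc n))) = ++⁺ (level-unique-elements (suc (suc n))) (chosen-unique n) disjoint
  where
  disjoint : ∀ {v} → ¬ (v ∈ level (suc (suc n)) × v ∈ chosen n)
  disjoint (v∈top , v∈rest) with chosen-levels n v∈rest
  ... | l , l≤n , at =
    1+n≰n (≤-trans (n≤1+n (suc n)) (subst (_≤ n) (sym (level-unique (level⁻ (suc (suc n)) v∈top) at)) l≤n))

halve : ∀ v → ∃[ p ] TreeEdge p v
halve zero = 0 , inj₁ refl
halve (suc v) with halve v
... | p , inj₁ e = p , inj₂ (trans (cong suc e) (+-comm 1 (2 * p)))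
... | p , inj₂ e = suc p , inj₁ (trans (cong suc e) (odd-suc p))
  where
  odd-suc : ∀ p → suc (2 * p + 1) ≡ 2 * suc p
  odd-suc = solve-∀

edge-bounds : ∀ {p v} → TreeEdge p v → 2 * p ≤ v × v ≤ 2 * p + 1
edge-bounds {p} (inj₁ refl) = ≤-refl , m≤m+n (2 * p) 1
edge-bounds {p} (inj₂ refl) = m≤m+n (2 * p) 1 , ≤-refl

parent-level : ∀ {m v} → AtLevel (suc m) v → ∃[ p ] (TreeEdge p v × AtLevel m p)
parent-level {m} {v} (lower , upper) with halve v
... | p , edge = p , edge , p-lower , p-upper
  where
  2p≤v : 2 * p ≤ v
  2p≤v = proj₁ (edge-bounds {p} {v} edge)
  v≤2p+1 : v ≤ 2 * p + 1
  v≤2p+1 = proj₂ (edge-bounds {p} {v} edge)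
  p-lower : 2 ^ m ≤ p
  p-lower = s≤s⁻¹ (*-cancelˡ-< 2 (2 ^ m) (suc p)
              (≤-trans (s≤s lower) (≤-trans (s≤s v≤2p+1) (≤-reflexive (double-suc p)))))
    where
    double-suc : ∀ p → suc (2 * p + 1) ≡ 2 * suc p
    double-suc = solve-∀
  p-upper : p < 2 ^ suc m
  p-upper = *-cancelˡ-< 2 p (2 ^ suc m) (≤-trans (s≤s 2p≤v) upper)

child-level : ∀ {m v} → AtLevel m v → AtLevel (suc m) (2 * v)
child-level (lower , upper) = *-monoʳ-≤ 2 lower , *-monoʳ-< 2 upper

Covered : ℕ → ℕ → Set
Covered n v = v ∈ chosen n ⊎ (∃[ p ] (TreeEdge p v × p ∈ chosen n)) ⊎ 2 * v ∈ chosen n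

by-parent : ∀ n m {v} → AtLevel (suc m) v → (∀ {p} → AtLevel m p → p ∈ chosen n) → Covered n v
by-parent n m {v} at chosen-level with parent-level {m} {v} at
... | p , edge , p-at = inj₂ (inj₁ (p , edge , chosen-level p-at))

by-child : ∀ n m {v} → AtLevel m v → (∀ {c} → AtLevel (suc m) c → c ∈ chosen n) → Covered n v
by-child n m {v} at chosen-level = inj₂ (inj₂ (chosen-level (child-level {m} {v} at)))

covered-+3 : ∀ n {v} → Covered n v → Covered (3 + n) v
covered-+3 n (inj₁ v∈) = inj₁ (∈-++⁺ʳ (level (2 + n)) v∈)
covered-+3 n (inj₂ (inj₁ (p , edge , p∈))) = inj₂ (inj₁ (p , edge , ∈-++⁺ʳ (level (2 + n)) p∈))
covered-+3 n (inj₂ (inj₂ c∈)) = inj₂ (inj₂ (∈-++⁺ʳ (level (2 + n)) c∈))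

-- Every vertex on a level l ≤ n is covered: the top three levels of
-- HT(n + 3) are covered by level n + 2, the others by induction.
covered : ∀ n {l v} → AtLevel l v → l ≤ n → Covered n v
covered zero {zero} at _ = inj₁ (level⁺ 0 at)
covered (suc zero) {zero} at _ = inj₁ (level⁺ 0 at)
covered (suc zero) {suc zero} at _ = by-parent 1 0 at (level⁺ 0)
covered (suc zero) {suc (suc l)} at (s≤s ())
covered (suc (suc zero)) {zero} at _ = by-child 2 0 at (level⁺ 1)
covered (suc (suc zero)) {suc zero} at _ = inj₁ (level⁺ 1 at)
covered (suc (suc zero)) {suc (suc zero)} at _ = by-parent 2 1 at (level⁺ 1)
covered (suc (suc zero)) {suc (suc (suc l))} at (s≤s (s≤s ()))
covered (suc (suc (suc n))) at l≤n+3 with m≤n⇒m<n∨m≡n l≤n+3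
... | inj₂ refl = by-parent (3 + n) (2 + n) at (λ p-at → ∈-++⁺ˡ (level⁺ (2 + n) p-at))
... | inj₁ (s≤s l≤n+2) with m≤n⇒m<n∨m≡n l≤n+2
...   | inj₂ refl = inj₁ (∈-++⁺ˡ (level⁺ (2 + n) at))
...   | inj₁ (s≤s l≤n+1) with m≤n⇒m<n∨m≡n l≤n+1
...     | inj₂ refl = by-child (3 + n) (1 + n) at (λ c-at → ∈-++⁺ˡ (level⁺ (2 + n) c-at))
...     | inj₁ (s≤s l≤n) = covered-+3 n (covered n at l≤n)

some-level : ∀ k {v} → 1 ≤ v → v < 2 ^ k → ∃[ l ] (l < k × AtLevel l v)
some-level zero positive small = ⊥-elim (<⇒≱ small positive)
some-level (suc k) {v} positive small with v <? 2 ^ k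
... | yes smaller = let (l , l<k , at) = some-level k positive smaller in l , m<n⇒m<1+n l<k , at
... | no ¬smaller = k , ≤-refl , ≮⇒≥ ¬smaller , small

chosen-dominating : ∀ n → IsDominating n (chosen n)
chosen-dominating n = chosen-unique n , chosen-vertices n , dominated
  where
  vertex : ∀ {u} → u ∈ chosen n → IsVertex n u
  vertex = All-lookup (chosen-vertices n)
  dominated : ∀ v → IsVertex n v → v ∈ chosen n ⊎ Any (λ s → Adj n s v) (chosen n)
  dominated v v-vertex@(positive , small) with some-level (suc n) positive small
  ... | l , s≤s l≤n , at with covered n at l≤n
  ...   | inj₁ v∈ = inj₁ v∈
  ...   | inj₂ (inj₁ (p , edge , p∈)) = inj₂ (lose p∈ (vertex p∈ , v-vertex , inj₁ edge))
  ...   | inj₂ (inj₂ c∈) = inj₂ (lose c∈ (vertex c∈ , v-vertex , inj₂ (inj₁ (inj₁ refl))))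

theorem1 : (n : ℕ) → 1 ≤ n → DominationNumber n (formula n)
theorem1 n _ =
  (chosen n , chosen-dominating n , sym (closedForm⇒formula n _ (chosen-closedForm n)))
  , lower-bound n
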